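{- For integers $n,k\ge 0$, let $\chi^{\mathrm{set}}_n(k)$ denote the number of functions $c:[n]\to\mathcal{P}_k$ (where $[n]=\{1,\dots,n\}$ and $\mathcal{P}_k$ is the power set of $[k]=\{1,\dots,k\}$) such that the cardinalities $|c(1)|,\dots,|c(n)|$ are pairwise distinct; set $\chi^{\mathrm{set}}_0(k)=1$. Then for every $k\ge 0$, as formal power series in $t$, \[ \sum_{n=0}^\infty \chi^{\mathrm{set}}_n(k)\,\frac{t^n}{n!} \;=\; \prod_{j=0}^k \Big[1+\binom{k}{j}t\Big]. \]
   Context: Combinatorially, $\chi^{\mathrm{set}}_n(k)$ counts the ways to put into each of $n$ labelled urns a set of balls of distinct colors chosen from $k$ colors, so that all urns contain different numbers of colors. -}

module Defs where

open import Data.Nat using (ℕ; zero; suc; _+_; _*_; _≟_)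
open import Data.Nat.Combinatorics using (_C_)
open import Data.Bool using (true; false)
open import Data.List using (List; []; _∷_; map; concatMap; filter; length; upTo)
open import Data.Vec using (Vec; []; _∷_; toList)
open import Data.Fin.Subset using (Subset; ∣_∣)
open import Data.List.Relation.Unary.Unique.DecPropositional _≟_ using (unique?)

allSubsets : (k : ℕ) → List (Subset k)
allSubsets zero    = [] ∷ []
allSubsets (suc k) = concatMap (λ s → (true ∷ s) ∷ (false ∷ s) ∷ []) (allSubsets k)

-- All functions [n] → A (as length-n vectors), given an enumeration of A.
allVecs : {A : Set} → List A → (n : ℕ) → List (Vec A n)
allVecs xs zero    = [] ∷ []
allVecs xs (suc n) = concatMap (λ x → map (x ∷_) (allVecs xs n)) xs

chiSet : ℕ → ℕ → ℕ
chiSet n k = length (filter (λ c → unique? (map ∣_∣ (toList c))) (allVecs (allSubsets k) n))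

-- Polynomials over ℕ as coefficient lists (constant term first).
Poly : Set
Poly = List ℕ

_+ₚ_ : Poly → Poly → Poly
[]       +ₚ q        = q
(a ∷ p)  +ₚ []       = a ∷ p
(a ∷ p)  +ₚ (b ∷ q)  = (a + b) ∷ (p +ₚ q)

_*ₚ_ : Poly → Poly → Poly
[]      *ₚ q = []
(a ∷ p) *ₚ q = map (a *_) q +ₚ (0 ∷ (p *ₚ q))

productₚ : List Poly → Poly
productₚ []       = 1 ∷ []
productₚ (p ∷ ps) = p *ₚ productₚ ps

coeff : Poly → ℕ → ℕ
coeff []      n       = 0
coeff (a ∷ p) zero    = a
coeff (a ∷ p) (suc n) = coeff p n

rhsPoly : ℕ → Poly
rhsPoly k = productₚ (map (λ j → 1 ∷ (k C j) ∷ []) (upTo (suc k)))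

{-# OPTIONS --safe #-}
-- Filling the urns one at a time, each new urn receives a set whose size j has not occurred yet, in
-- C(k,j) ways. So χₙ(k) is the sum over injective sequences of sizes (j₁,…,jₙ) of ∏ C(k,jᵢ),
-- which is n! times the elementary symmetric polynomial eₙ of the weights C(k,0),…,C(k,k), i.e.
-- n! times the coefficient of tⁿ in ∏ⱼ (1 + C(k,j) t). The first equality is proved by induction
-- on n, keeping track of the sizes already used; its inductive step is Euler's identity
-- Σⱼ wⱼ ∂ⱼ eₙ₊₁ = (n+1) eₙ₊₁.
module Submission where

open import Defs
open import Data.Nat using (ℕ; _*_)
open import Data.Nat using (_!)
open import Relation.Binary.PropositionalEquality using (_≡_)

import Algebra.Properties.CommutativeSemigroup as CommutativeSemigroupProperties
open import Data.Nat using (zero; suc; _+_; _≟_; s≤s)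
open import Relation.Binary.PropositionalEquality
  using (refl; sym; trans; cong; cong₂; subst; _≢_; ≢-sym; setoid; module ≡-Reasoning)
open import Data.Bool using (true; false; if_then_else_)
open import Data.Fin.Subset using (Subset; ∣_∣)
open import Data.Fin.Subset.Properties using (∣p∣≤n)
open import Data.List using (List; []; _∷_; [_]; _++_; map; foldr; concatMap; filter; length; upTo)
open import Data.List.Membership.DecPropositional _≟_ using (_∈?_)
open import Data.List.Membership.Propositional using (_∈_; _∉_)
open import Data.List.Membership.Propositional.Properties using (∈-upTo⁺)
open import Data.List.Properties
  using (++-identityʳ; length-++; filter-++; filter-≐; filter-none; filter-accept; filter-reject;
         map-cong; map-cong-local)
open import Data.List.Relation.Binary.Permutation.Setoid (setoid ℕ) using (↭-sym)
open import Data.List.Relation.Binary.Permutation.Setoid.Properties (setoid ℕ) using (Unique-resp-↭; ↭-shift)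
open import Data.List.Relation.Unary.All as All using (All; []; _∷_)
import Data.List.Relation.Unary.All.Properties as All
open import Data.List.Relation.Unary.All.Properties.Core using (¬Any⇒All¬)
open import Data.List.Relation.Unary.AllPairs using ([]; _∷_)
open import Data.List.Relation.Unary.Any using (here; there)
open import Data.List.Relation.Unary.Unique.DecPropositional _≟_ using (unique?)
open import Data.List.Relation.Unary.Unique.Propositional using (Unique)
open import Data.List.Relation.Unary.Unique.Propositional.Properties using (upTo⁺; Unique[x∷xs]⇒x∉xs)
open import Data.Nat.Combinatorics using (_C_; nCk+nC[k+1]≡[n+1]C[k+1])
open import Data.Nat.ListAction using (sum)
open import Data.Nat.Properties
  using (+-identityʳ; +-suc; *-identityˡ; *-zeroʳ; *-distribˡ-+; *-distribʳ-+; suc-injective;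
         +-commutativeSemigroup; *-commutativeSemigroup)
open import Data.Nat.Tactic.RingSolver using (solve-∀)
open import Data.Product using (_,_)
open import Data.Vec using (Vec; toList) renaming (_∷_ to _∷ᵥ_)
open import Function using (_∘_)
open import Level using (0ℓ)
open import Relation.Nullary using (¬_; does; yes; no)
open import Relation.Nullary.Decidable using (dec-true; dec-false)
open import Relation.Unary using (Pred; Decidable; ∁; _≐_)

open CommutativeSemigroupProperties +-commutativeSemigroup using (interchange)
open CommutativeSemigroupProperties *-commutativeSemigroup using (x∙yz≈y∙xz; x∙yz≈yx∙z)

open ≡-Reasoning

∑ : {A : Set} → List A → (A → ℕ) → ℕ
∑ xs f = sum (map f xs)

infix 5 ∑
syntax ∑ xs (λ x → f) = ∑[ x ∈ xs ] f

module _ {A : Set} where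

  ∑-cong : {f g : A → ℕ} (xs : List A) → (∀ x → f x ≡ g x) → ∑ xs f ≡ ∑ xs g
  ∑-cong xs f≗g = cong sum (map-cong f≗g xs)

  ∑-cong-local : {f g : A → ℕ} {xs : List A} → All (λ x → f x ≡ g x) xs → ∑ xs f ≡ ∑ xs g
  ∑-cong-local f≡g = cong sum (map-cong-local f≡g)

  ∑-distrib-+ : (xs : List A) (f g : A → ℕ) → ∑[ x ∈ xs ] (f x + g x) ≡ ∑ xs f + ∑ xs g
  ∑-distrib-+ []       f g = refl
  ∑-distrib-+ (x ∷ xs) f g =
    trans (cong (f x + g x +_) (∑-distrib-+ xs f g)) (interchange (f x) (g x) (∑ xs f) (∑ xs g))

  ∑-distribˡ-* : (a : ℕ) (xs : List A) (f : A → ℕ) → ∑[ x ∈ xs ] a * f x ≡ a * ∑ xs f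
  ∑-distribˡ-* a []       f = sym (*-zeroʳ a)
  ∑-distribˡ-* a (x ∷ xs) f =
    trans (cong (a * f x +_) (∑-distribˡ-* a xs f)) (sym (*-distribˡ-+ a (f x) (∑ xs f)))

count : {A : Set} {P : Pred A 0ℓ} → Decidable P → List A → ℕ
count P? xs = length (filter P? xs)

module _ {A : Set} {P : Pred A 0ℓ} (P? : Decidable P) where

  count-++ : (xs ys : List A) → count P? (xs ++ ys) ≡ count P? xs + count P? ys
  count-++ xs ys = trans (cong length (filter-++ P? xs ys)) (length-++ (filter P? xs))

  count-concatMap : {B : Set} (f : B → List A) (ys : List B) →
                    count P? (concatMap f ys) ≡ ∑[ y ∈ ys ] count P? (f y)
  count-concatMap f []       = refl
  count-concatMap f (y ∷ ys) =
    trans (count-++ (f y) (concatMap f ys)) (cong (count P? (f y) +_) (count-concatMap f ys))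

  count-map : {B : Set} (g : B → A) (ys : List B) → count P? (map g ys) ≡ count (P? ∘ g) ys
  count-map g []       = refl
  count-map g (y ∷ ys) with does (P? (g y))
  ... | true  = cong suc (count-map g ys)
  ... | false = count-map g ys

  count-none : {xs : List A} → All (∁ P) xs → count P? xs ≡ 0
  count-none ¬Pxs = cong length (filter-none P? ¬Pxs)

  count-≐ : {Q : Pred A 0ℓ} (Q? : Decidable Q) → P ≐ Q → (xs : List A) → count P? xs ≡ count Q? xs
  count-≐ Q? P≐Q xs = cong length (filter-≐ P? Q? P≐Q xs)

module _ {A : Set} (key : A → ℕ) where

  key≟ : (j : ℕ) → Decidable (λ x → key x ≡ j)
  key≟ j x = key x ≟ j

  count-singleton-reject : {x : A} {j : ℕ} → key x ≢ j → count (key≟ j) [ x ] ≡ 0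
  count-singleton-reject {x} {j} x≢j = cong length (filter-reject (key≟ j) x≢j)

  ∑-count-singleton : (h : ℕ → ℕ) {x : A} {U : List ℕ} → Unique U → key x ∈ U →
                      ∑[ j ∈ U ] count (key≟ j) [ x ] * h j ≡ h (key x)
  ∑-count-singleton h {x} {_ ∷ U} (x∉U ∷ _) (here refl) = begin
      count (key≟ (key x)) [ x ] * h (key x) + (∑[ j ∈ U ] count (key≟ j) [ x ] * h j)
    ≡⟨ cong₂ _+_ (cong (λ c → c * h (key x)) (cong length (filter-accept (key≟ (key x)) refl)))
                 (∑-cong-local (All.map (λ {j} x≢j → cong (λ c → c * h j) (count-singleton-reject x≢j)) x∉U)) ⟩
      1 * h (key x) + (∑[ j ∈ U ] 0 * h j)
    ≡⟨ cong (1 * h (key x) +_) (∑-distribˡ-* 0 U h) ⟩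
      1 * h (key x) + 0
    ≡⟨ trans (+-identityʳ _) (*-identityˡ _) ⟩
      h (key x)
    ∎
  ∑-count-singleton h {x} {i ∷ U} (i∉U ∷ uU) (there x∈U) =
    trans (cong (λ c → c * h i + _) (count-singleton-reject (≢-sym (All.lookup i∉U x∈U))))
          (∑-count-singleton h uU x∈U)

  ∑-by-multiplicity : (h : ℕ → ℕ) {U : List ℕ} → Unique U → (xs : List A) → All (λ x → key x ∈ U) xs →
                      ∑[ x ∈ xs ] h (key x) ≡ ∑[ j ∈ U ] count (key≟ j) xs * h j
  ∑-by-multiplicity h {U} uU []       []            = sym (∑-distribˡ-* 0 U h)
  ∑-by-multiplicity h {U} uU (x ∷ xs) (x∈U ∷ xs⊆U) = begin
      h (key x) + (∑[ y ∈ xs ] h (key y))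
    ≡⟨ cong₂ _+_ (sym (∑-count-singleton h uU x∈U)) (∑-by-multiplicity h uU xs xs⊆U) ⟩
      (∑[ j ∈ U ] mult [ x ] j * h j) + (∑[ j ∈ U ] mult xs j * h j)
    ≡⟨ sym (∑-distrib-+ U _ _) ⟩
      ∑[ j ∈ U ] mult [ x ] j * h j + mult xs j * h j
    ≡⟨ ∑-cong U (λ j → sym (*-distribʳ-+ (h j) (mult [ x ] j) (mult xs j))) ⟩
      ∑[ j ∈ U ] (mult [ x ] j + mult xs j) * h j
    ≡⟨ ∑-cong U (λ j → cong (_* h j) (sym (count-++ (key≟ j) [ x ] xs))) ⟩
      ∑[ j ∈ U ] mult (x ∷ xs) j * h j
    ∎
    where
      mult : List A → ℕ → ℕ
      mult ys j = count (key≟ j) ys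

esym : List ℕ → ℕ → ℕ
esym _        zero    = 1
esym []       (suc n) = 0
esym (w ∷ ws) (suc n) = esym ws (suc n) + w * esym ws n

esym-0∷ : (ws : List ℕ) (n : ℕ) → esym (0 ∷ ws) n ≡ esym ws n
esym-0∷ ws zero    = refl
esym-0∷ ws (suc n) = +-identityʳ _

zeroAt : ℕ → (ℕ → ℕ) → ℕ → ℕ
zeroAt j w x = if does (x ≟ j) then 0 else w x

zeroAt-≡ : (w : ℕ → ℕ) (j : ℕ) → zeroAt j w j ≡ 0
zeroAt-≡ w j = cong (λ b → if b then 0 else w j) (dec-true (j ≟ j) refl)

zeroAt-≢ : (w : ℕ → ℕ) {j x : ℕ} → x ≢ j → zeroAt j w x ≡ w x
zeroAt-≢ w {j} {x} x≢j = cong (λ b → if b then 0 else w x) (dec-false (x ≟ j) x≢j)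

zeroAt-0 : (w : ℕ → ℕ) {j x : ℕ} → w x ≡ 0 → zeroAt j w x ≡ 0
zeroAt-0 w {j} {x} wx≡0 with does (x ≟ j)
... | true  = refl
... | false = wx≡0

zeroOn : List ℕ → (ℕ → ℕ) → ℕ → ℕ
zeroOn F w = foldr zeroAt w F

zeroOn-∈ : (w : ℕ → ℕ) {j : ℕ} {F : List ℕ} → j ∈ F → zeroOn F w j ≡ 0
zeroOn-∈ w {F = j ∷ F} (here refl) = zeroAt-≡ (zeroOn F w) j
zeroOn-∈ w {F = i ∷ F} (there j∈F) = zeroAt-0 (zeroOn F w) (zeroOn-∈ w j∈F)

zeroOn-∉ : (w : ℕ → ℕ) {j : ℕ} (F : List ℕ) → j ∉ F → zeroOn F w j ≡ w j
zeroOn-∉ w []      j∉F = refl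
zeroOn-∉ w (i ∷ F) j∉F = trans (zeroAt-≢ (zeroOn F w) (j∉F ∘ here)) (zeroOn-∉ w F (j∉F ∘ there))

-- Euler's identity for the homogeneous e_{n+1}, whose partial derivative in w_j is e_n at w_j = 0.
esym-euler : (w : ℕ → ℕ) {U : List ℕ} → Unique U → (n : ℕ) →
             ∑[ j ∈ U ] w j * esym (map (zeroAt j w) U) n ≡ suc n * esym (map w U) (suc n)
esym-euler w {[]}    []           n = sym (*-zeroʳ (suc n))
esym-euler w {i ∷ U} (i∉U ∷ uU) n = begin
    w i * esym (zeroAt i w i ∷ V i) n + (∑[ j ∈ U ] w j * esym (zeroAt j w i ∷ V j) n)
  ≡⟨ cong₂ _+_ (cong (w i *_) drop-i)
               (∑-cong-local (All.map (λ {j} i≢j → cong (λ z → w j * esym (z ∷ V j) n) (zeroAt-≢ w i≢j))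
                                      i∉U)) ⟩
    w i * esym W n + (∑[ j ∈ U ] w j * esym (w i ∷ V j) n)
  ≡⟨ prepend n ⟩
    suc n * esym (w i ∷ W) (suc n)
  ∎
  where
    V : ℕ → List ℕ
    V j = map (zeroAt j w) U

    W : List ℕ
    W = map w U

    D : ℕ → ℕ
    D k = ∑[ j ∈ U ] w j * esym (V j) k

    drop-i : esym (zeroAt i w i ∷ V i) n ≡ esym W n
    drop-i = begin
        esym (zeroAt i w i ∷ V i) n
      ≡⟨ cong (λ z → esym (z ∷ V i) n) (zeroAt-≡ w i) ⟩
        esym (0 ∷ V i) n
      ≡⟨ esym-0∷ (V i) n ⟩
        esym (V i) n
      ≡⟨ cong (λ ws → esym ws n) (map-cong-local (All.map (λ i≢j → zeroAt-≢ w (≢-sym i≢j)) i∉U)) ⟩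
        esym W n
      ∎

    prepend : (n : ℕ) →
              w i * esym W n + (∑[ j ∈ U ] w j * esym (w i ∷ V j) n) ≡ suc n * esym (w i ∷ W) (suc n)
    prepend zero = begin
        w i * 1 + D 0
      ≡⟨ cong (w i * 1 +_) (esym-euler w uU 0) ⟩
        w i * 1 + 1 * esym W 1
      ≡⟨ rearrange (w i) (esym W 1) ⟩
        1 * esym (w i ∷ W) 1
      ∎
      where
        rearrange : ∀ a x → a * 1 + 1 * x ≡ 1 * (x + a * 1)
        rearrange = solve-∀
    prepend (suc m) = begin
        w i * E₁ + (∑[ j ∈ U ] w j * (esym (V j) (suc m) + w i * esym (V j) m))
      ≡⟨ cong (w i * E₁ +_) (∑-cong U (λ j → expand (w i) (w j) _ _)) ⟩
        w i * E₁ + (∑[ j ∈ U ] w j * esym (V j) (suc m) + w i * (w j * esym (V j) m))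
      ≡⟨ cong (w i * E₁ +_) (trans (∑-distrib-+ U _ _) (cong (D (suc m) +_) (∑-distribˡ-* (w i) U _))) ⟩
        w i * E₁ + (D (suc m) + w i * D m)
      ≡⟨ cong₂ (λ x y → w i * E₁ + (x + w i * y)) (esym-euler w uU (suc m)) (esym-euler w uU m) ⟩
        w i * E₁ + (suc (suc m) * E₂ + w i * (suc m * E₁))
      ≡⟨ rearrange (w i) E₁ E₂ m ⟩
        suc (suc m) * (E₂ + w i * E₁)
      ∎
      where
        expand : ∀ a b x y → b * (x + a * y) ≡ b * x + a * (b * y)
        expand = solve-∀
        rearrange : ∀ a x y m → a * x + (suc (suc m) * y + a * (suc m * x)) ≡ suc (suc m) * (y + a * x)
        rearrange = solve-∀
        E₁ E₂ : ℕ
        E₁ = esym W (suc m)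
        E₂ = esym W (suc (suc m))

coeff-+ₚ : (p q : Poly) (n : ℕ) → coeff (p +ₚ q) n ≡ coeff p n + coeff q n
coeff-+ₚ []      q       n       = refl
coeff-+ₚ (a ∷ p) []      n       = sym (+-identityʳ _)
coeff-+ₚ (a ∷ p) (b ∷ q) zero    = refl
coeff-+ₚ (a ∷ p) (b ∷ q) (suc n) = coeff-+ₚ p q n

coeff-map-* : (a : ℕ) (p : Poly) (n : ℕ) → coeff (map (a *_) p) n ≡ a * coeff p n
coeff-map-* a []      n       = sym (*-zeroʳ a)
coeff-map-* a (b ∷ p) zero    = refl
coeff-map-* a (b ∷ p) (suc n) = coeff-map-* a p n

coeff-[0] : (n : ℕ) → coeff (0 ∷ []) n ≡ 0
coeff-[0] zero    = refl
coeff-[0] (suc n) = refl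

coeff-linear-*ₚ-zero : (w : ℕ) (p : Poly) → coeff ((1 ∷ w ∷ []) *ₚ p) 0 ≡ coeff p 0
coeff-linear-*ₚ-zero w p = begin
    coeff (map (1 *_) p +ₚ (0 ∷ ((w ∷ []) *ₚ p))) 0
  ≡⟨ coeff-+ₚ (map (1 *_) p) _ 0 ⟩
    coeff (map (1 *_) p) 0 + 0
  ≡⟨ trans (+-identityʳ _) (coeff-map-* 1 p 0) ⟩
    1 * coeff p 0
  ≡⟨ *-identityˡ _ ⟩
    coeff p 0
  ∎

coeff-linear-*ₚ-suc : (w : ℕ) (p : Poly) (n : ℕ) →
                      coeff ((1 ∷ w ∷ []) *ₚ p) (suc n) ≡ coeff p (suc n) + w * coeff p n
coeff-linear-*ₚ-suc w p n = begin
    coeff (map (1 *_) p +ₚ (0 ∷ (map (w *_) p +ₚ (0 ∷ [])))) (suc n)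
  ≡⟨ coeff-+ₚ (map (1 *_) p) _ (suc n) ⟩
    coeff (map (1 *_) p) (suc n) + coeff (map (w *_) p +ₚ (0 ∷ [])) n
  ≡⟨ cong₂ _+_ (trans (coeff-map-* 1 p (suc n)) (*-identityˡ _)) (coeff-+ₚ (map (w *_) p) (0 ∷ []) n) ⟩
    coeff p (suc n) + (coeff (map (w *_) p) n + coeff (0 ∷ []) n)
  ≡⟨ cong (coeff p (suc n) +_) (cong₂ _+_ (coeff-map-* w p n) (coeff-[0] n)) ⟩
    coeff p (suc n) + (w * coeff p n + 0)
  ≡⟨ cong (coeff p (suc n) +_) (+-identityʳ _) ⟩
    coeff p (suc n) + w * coeff p n
  ∎

∏-linear : (ℕ → ℕ) → List ℕ → Poly
∏-linear f U = productₚ (map (λ j → 1 ∷ f j ∷ []) U)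

coeff-∏-linear : (f : ℕ → ℕ) (U : List ℕ) (n : ℕ) → coeff (∏-linear f U) n ≡ esym (map f U) n
coeff-∏-linear f []      zero    = refl
coeff-∏-linear f []      (suc n) = refl
coeff-∏-linear f (j ∷ U) zero    =
  trans (coeff-linear-*ₚ-zero (f j) (∏-linear f U)) (coeff-∏-linear f U zero)
coeff-∏-linear f (j ∷ U) (suc n) =
  trans (coeff-linear-*ₚ-suc (f j) (∏-linear f U) n)
        (cong₂ (λ x y → x + f j * y) (coeff-∏-linear f U (suc n)) (coeff-∏-linear f U n))

Unique-++⁻ˡ : {A : Set} (xs : List A) {ys : List A} → Unique (xs ++ ys) → Unique xs
Unique-++⁻ˡ []       _            = []
Unique-++⁻ˡ (x ∷ xs) (x∉ ∷ uxsys) = All.++⁻ˡ xs x∉ ∷ Unique-++⁻ˡ xs uxsys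

module DistinctKeys {A : Set} (key : A → ℕ) (xs : List A) where

  keys : {n : ℕ} → Vec A n → List ℕ
  keys v = map key (toList v)

  distinctAvoiding? : (F : List ℕ) {n : ℕ} → Decidable (λ (v : Vec A n) → Unique (F ++ keys v))
  distinctAvoiding? F v = unique? (F ++ keys v)

  distinctAvoiding : List ℕ → ℕ → ℕ
  distinctAvoiding F n = count (distinctAvoiding? F) (allVecs xs n)

  distinctAvoiding-zero : {F : List ℕ} → Unique F → distinctAvoiding F 0 ≡ 1
  distinctAvoiding-zero {F} uF =
    cong length (filter-accept (distinctAvoiding? F) (subst Unique (sym (++-identityʳ F)) uF))

  distinctAvoiding-nonUnique : {F : List ℕ} → ¬ Unique F → (n : ℕ) → distinctAvoiding F n ≡ 0
  distinctAvoiding-nonUnique {F} ¬uF n =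
    count-none (distinctAvoiding? F) (All.universal (λ v → ¬uF ∘ Unique-++⁻ˡ F) (allVecs xs n))

  distinctAvoiding-suc : (F : List ℕ) (n : ℕ) →
                         distinctAvoiding F (suc n) ≡ ∑[ x ∈ xs ] distinctAvoiding (key x ∷ F) n
  distinctAvoiding-suc F n = begin
      count (distinctAvoiding? F) (concatMap (λ x → map (x ∷ᵥ_) (allVecs xs n)) xs)
    ≡⟨ count-concatMap (distinctAvoiding? F) _ xs ⟩
      ∑[ x ∈ xs ] count (distinctAvoiding? F) (map (x ∷ᵥ_) (allVecs xs n))
    ≡⟨ ∑-cong xs (λ x → trans (count-map (distinctAvoiding? F) (x ∷ᵥ_) (allVecs xs n))
                              (count-≐ _ (distinctAvoiding? (key x ∷ F)) shift (allVecs xs n))) ⟩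
      ∑[ x ∈ xs ] distinctAvoiding (key x ∷ F) n
    ∎
    where
      shift : {a : ℕ} → (λ v → Unique (F ++ a ∷ keys v)) ≐ (λ v → Unique (a ∷ F ++ keys {n} v))
      shift = (λ {v} → Unique-resp-↭ (↭-shift F (keys v)))
            , (λ {v} → Unique-resp-↭ (↭-sym (↭-shift F (keys v))))

  multiplicity : ℕ → ℕ
  multiplicity j = count (λ x → key x ≟ j) xs

  module _ {U : List ℕ} (uU : Unique U) (keys⊆U : All (λ x → key x ∈ U) xs) where

    -- Keys in F can no longer be used, which is the same as giving them multiplicity 0.
    distinctAvoiding-closed : (n : ℕ) {F : List ℕ} → Unique F →
                              distinctAvoiding F n ≡ n ! * esym (map (zeroOn F multiplicity) U) n
    distinctAvoiding-closed zero    uF = distinctAvoiding-zero uF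
    distinctAvoiding-closed (suc n) {F} uF = begin
        distinctAvoiding F (suc n)
      ≡⟨ distinctAvoiding-suc F n ⟩
        ∑[ x ∈ xs ] distinctAvoiding (key x ∷ F) n
      ≡⟨ ∑-by-multiplicity key (λ j → distinctAvoiding (j ∷ F) n) uU xs keys⊆U ⟩
        ∑[ j ∈ U ] multiplicity j * distinctAvoiding (j ∷ F) n
      ≡⟨ ∑-cong U term ⟩
        ∑[ j ∈ U ] n ! * (w j * E j)
      ≡⟨ ∑-distribˡ-* (n !) U _ ⟩
        n ! * (∑[ j ∈ U ] w j * E j)
      ≡⟨ cong (n ! *_) (esym-euler w uU n) ⟩
        n ! * (suc n * esym (map w U) (suc n))
      ≡⟨ x∙yz≈yx∙z (n !) (suc n) (esym (map w U) (suc n)) ⟩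
        suc n ! * esym (map w U) (suc n)
      ∎
      where
        w : ℕ → ℕ
        w = zeroOn F multiplicity

        E : ℕ → ℕ
        E j = esym (map (zeroAt j w) U) n

        term : (j : ℕ) → multiplicity j * distinctAvoiding (j ∷ F) n ≡ n ! * (w j * E j)
        term j with j ∈? F
        ... | yes j∈F = begin
            multiplicity j * distinctAvoiding (j ∷ F) n
          ≡⟨ cong (multiplicity j *_) (distinctAvoiding-nonUnique (λ u → Unique[x∷xs]⇒x∉xs u j∈F) n) ⟩
            multiplicity j * 0
          ≡⟨ trans (*-zeroʳ (multiplicity j)) (sym (*-zeroʳ (n !))) ⟩
            n ! * (0 * E j)
          ≡⟨ cong (λ c → n ! * (c * E j)) (sym (zeroOn-∈ multiplicity j∈F)) ⟩
            n ! * (w j * E j)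
          ∎
        ... | no j∉F = begin
            multiplicity j * distinctAvoiding (j ∷ F) n
          ≡⟨ cong (multiplicity j *_) (distinctAvoiding-closed n (¬Any⇒All¬ F j∉F ∷ uF)) ⟩
            multiplicity j * (n ! * E j)
          ≡⟨ x∙yz≈y∙xz (multiplicity j) (n !) (E j) ⟩
            n ! * (multiplicity j * E j)
          ≡⟨ cong (λ c → n ! * (c * E j)) (sym (zeroOn-∉ multiplicity F j∉F)) ⟩
            n ! * (w j * E j)
          ∎

count-concatMap-pair : {A B : Set} {P : Pred A 0ℓ} (P? : Decidable P) (f g : B → A) (ys : List B) →
                       count P? (concatMap (λ y → f y ∷ g y ∷ []) ys)
                       ≡ count (P? ∘ f) ys + count (P? ∘ g) ys
count-concatMap-pair P? f g []       = refl
count-concatMap-pair P? f g (y ∷ ys) with does (P? (f y))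
... | true  with does (P? (g y))
...   | true  = cong suc (trans (cong suc (count-concatMap-pair P? f g ys)) (sym (+-suc _ _)))
...   | false = cong suc (count-concatMap-pair P? f g ys)
count-concatMap-pair P? f g (y ∷ ys) | false with does (P? (g y))
...   | true  = trans (cong suc (count-concatMap-pair P? f g ys)) (sym (+-suc _ _))
...   | false = count-concatMap-pair P? f g ys

count-subsets-ofSize : (k j : ℕ) → count (λ s → ∣ s ∣ ≟ j) (allSubsets k) ≡ k C j
count-subsets-ofSize zero    zero    = refl
count-subsets-ofSize zero    (suc j) = refl
count-subsets-ofSize (suc k) zero    =
  trans (count-concatMap-pair (λ s → ∣ s ∣ ≟ 0) (true ∷ᵥ_) (false ∷ᵥ_) (allSubsets k))
        (cong₂ _+_ (count-none (λ s → suc ∣ s ∣ ≟ 0) (All.universal (λ _ ()) (allSubsets k)))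
                   (count-subsets-ofSize k zero))
count-subsets-ofSize (suc k) (suc j) = begin
    count (ofSize (suc j)) (allSubsets (suc k))
  ≡⟨ count-concatMap-pair (ofSize (suc j)) (true ∷ᵥ_) (false ∷ᵥ_) (allSubsets k) ⟩
    count (λ s → suc ∣ s ∣ ≟ suc j) (allSubsets k) + count (ofSize (suc j)) (allSubsets k)
  ≡⟨ cong (_+ count (ofSize (suc j)) (allSubsets k))
          (count-≐ (λ s → suc ∣ s ∣ ≟ suc j) (ofSize j) (suc-injective , cong suc) (allSubsets k)) ⟩
    count (ofSize j) (allSubsets k) + count (ofSize (suc j)) (allSubsets k)
  ≡⟨ cong₂ _+_ (count-subsets-ofSize k j) (count-subsets-ofSize k (suc j)) ⟩
    k C j + k C suc j
  ≡⟨ nCk+nC[k+1]≡[n+1]C[k+1] k j ⟩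
    suc k C suc j
  ∎
  where
    ofSize : (i : ℕ) {m : ℕ} → Decidable (λ (s : Subset m) → ∣ s ∣ ≡ i)
    ofSize i s = ∣ s ∣ ≟ i

mainTheorem1 : (k n : ℕ) → chiSet n k ≡ (n !) * coeff (rhsPoly k) n
mainTheorem1 k n = begin
    chiSet n k
  ≡⟨⟩
    distinctAvoiding [] n
  ≡⟨ distinctAvoiding-closed uU sizes∈U n [] ⟩
    n ! * esym (map multiplicity U) n
  ≡⟨ cong (λ ws → n ! * esym ws n) (map-cong (count-subsets-ofSize k) U) ⟩
    n ! * esym (map (k C_) U) n
  ≡⟨ cong (n ! *_) (sym (coeff-∏-linear (k C_) U n)) ⟩
    n ! * coeff (rhsPoly k) n
  ∎
  where
    open DistinctKeys ∣_∣ (allSubsets k)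

    U : List ℕ
    U = upTo (suc k)

    uU : Unique U
    uU = upTo⁺ (suc k)

    sizes∈U : All (λ s → ∣ s ∣ ∈ U) (allSubsets k)
    sizes∈U = All.universal (λ s → ∈-upTo⁺ (s≤s (∣p∣≤n s))) (allSubsets k)
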